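{- Let $n \geq 2r$ and suppose that $\mathcal{A} \subseteq\binom{[n]}{r}$ is an MLCIF of rank $2$. Then either $\mathcal{A}=\mathcal{AHM}_3$ or $\mathcal{A} \in \bigcup_{j=2}^{r+1} \mathcal{I}_j$.
   Context: $\binom{[n]}{r}$ is the family of $r$-subsets of $[n]=\{1,\dots,n\}$. A family is intersecting if no two members are disjoint. For $A=\{a_1<\dots<a_r\}$, $B=\{b_1<\dots<b_r\}$ write $B\le A$ if $b_i\le a_i$ for all $i$; $\mathcal{A}$ is left-compressed if $A\in\mathcal{A}$, $B\le A$ imply $B\in\mathcal{A}$. An MLCIF is a left-compressed intersecting family in $\binom{[n]}{r}$ maximal under inclusion among such families. A set $G\subseteq[n]$ is a potential generator of $\mathcal{A}$ if every $A\in\binom{[n]}{r}$ with $G\subseteq A$ lies in $\mathcal{A}$; generators are inclusion-minimal potential generators, and the rank of $\mathcal{A}$ is the smallest size of a generator. $\mathcal{AHM}_3=\{A\in\binom{[n]}{r}: 1\in A, A\cap\{2,3\}\ne\emptyset\}\cup\{A\in\binom{[n]}{r}:\{2,3\}\subseteq A\}$. For $j\ge2$, $\mathcal{I}_j$ is the set of all MLCIFs in $\binom{[n]}{r}$ of rank two whose generators of size two are precisely $\{1,2\},\dots,\{1,j\}$. -}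

module Defs where

open import Data.Nat using (ℕ; zero; suc; _≤_; _∸_)
open import Data.Bool using (Bool; true; false; T)
open import Data.Vec using (Vec; []; _∷_)
open import Data.List using (List; []; _∷_; map)
open import Data.List.Membership.Propositional using (_∈_)
open import Data.List.Relation.Binary.Pointwise using (Pointwise)
open import Data.Fin.Subset using (Subset; ∣_∣; _⊆_; _∩_; Nonempty)
open import Data.Product using (Σ; ∃; _×_; _,_)
open import Data.Sum using (_⊎_)
open import Relation.Binary.PropositionalEquality using (_≡_; _≢_)
open import Relation.Nullary using (¬_)
open import Function.Bundles using (_⇔_)

-- Convention: the ground set [n] = {1,…,n} is represented by Fin n; the
-- paper's element k corresponds to index k-1 (toℕ).  Subsets are
-- Data.Fin.Subset (Vec Bool n).

elems : ∀ {n} → Subset n → List ℕ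
elems []          = []
elems (true ∷ v)  = 0 ∷ map suc (elems v)
elems (false ∷ v) = map suc (elems v)

-- "paper element k is in A" (k ≥ 1)
has : ∀ {n} → Subset n → ℕ → Set
has A k = k ∸ 1 ∈ elems A

Family : ℕ → Set
Family n = Subset n → Bool

_∈F_ : ∀ {n} → Subset n → Family n → Set
A ∈F 𝒜 = T (𝒜 A)

IsUniform : ∀ {n} → ℕ → Family n → Set
IsUniform {n} r 𝒜 = ∀ (A : Subset n) → A ∈F 𝒜 → ∣ A ∣ ≡ r

IsIntersecting : ∀ {n} → Family n → Set
IsIntersecting {n} 𝒜 = ∀ (A B : Subset n) → A ∈F 𝒜 → B ∈F 𝒜 → Nonempty (A ∩ B)

_≤ₛ_ : ∀ {n} → Subset n → Subset n → Set
B ≤ₛ A = Pointwise _≤_ (elems B) (elems A)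

IsLeftCompressed : ∀ {n} → Family n → Set
IsLeftCompressed {n} 𝒜 = ∀ (A B : Subset n) → A ∈F 𝒜 → B ≤ₛ A → B ∈F 𝒜

_⊆F_ : ∀ {n} → Family n → Family n → Set
_⊆F_ {n} 𝒜 ℬ = ∀ (A : Subset n) → A ∈F 𝒜 → A ∈F ℬ

IsLCIF : (n r : ℕ) → Family n → Set
IsLCIF n r 𝒜 = IsUniform r 𝒜 × IsLeftCompressed 𝒜 × IsIntersecting 𝒜

IsMLCIF : (n r : ℕ) → Family n → Set
IsMLCIF n r 𝒜 = IsLCIF n r 𝒜 × (∀ (ℬ : Family n) → IsLCIF n r ℬ → 𝒜 ⊆F ℬ → ℬ ⊆F 𝒜)

IsPotentialGenerator : ∀ {n} → ℕ → Family n → Subset n → Set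
IsPotentialGenerator {n} r 𝒜 G = ∀ (A : Subset n) → ∣ A ∣ ≡ r → G ⊆ A → A ∈F 𝒜

IsGenerator : ∀ {n} → ℕ → Family n → Subset n → Set
IsGenerator {n} r 𝒜 G =
  IsPotentialGenerator r 𝒜 G ×
  (∀ (H : Subset n) → H ⊆ G → H ≢ G → ¬ IsPotentialGenerator r 𝒜 H)

HasRank : ∀ {n} → ℕ → Family n → ℕ → Set
HasRank {n} r 𝒜 k =
  (Σ (Subset n) λ G → IsGenerator r 𝒜 G × ∣ G ∣ ≡ k) ×
  (∀ (G : Subset n) → IsGenerator r 𝒜 G → k ≤ ∣ G ∣)

_≐_ : ∀ {n} → Family n → Family n → Set
_≐_ {n} 𝒜 ℬ = ∀ (A : Subset n) → (A ∈F 𝒜) ⇔ (A ∈F ℬ)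

InAHM3 : ∀ {n} → ℕ → Subset n → Set
InAHM3 r A = ∣ A ∣ ≡ r ×
  ((has A 1 × (has A 2 ⊎ has A 3)) ⊎ (has A 2 × has A 3))

IsAHM3 : ∀ {n} → ℕ → Family n → Set
IsAHM3 {n} r 𝒜 = ∀ (A : Subset n) → (A ∈F 𝒜) ⇔ InAHM3 r A

-- 𝒜 ∈ I_j : an MLCIF of rank two whose size-two generators are exactly
-- {1,2}, …, {1,j}  (paper elements; indices 0 and k-1)
InI : (n r j : ℕ) → Family n → Set
InI n r j 𝒜 =
  IsMLCIF n r 𝒜 × HasRank r 𝒜 2 ×
  (∀ (G : Subset n) →
     (IsGenerator r 𝒜 G × ∣ G ∣ ≡ 2) ⇔
     (Σ ℕ λ k → 2 ≤ k × k ≤ j × elems G ≡ 0 ∷ k ∸ 1 ∷ []))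

-- Say that G generates when it is a potential generator.  Rank two means that
-- some pair generates but no set of size at most one does.  Left compression lets a generating pair {a,b} be shifted to every
-- pair {a′,b′} with a′ ≤ a, b′ ≤ b, and since 2r ≤ n a potential generator of
-- size at most r meets every member (otherwise extend it to an r-set disjoint
-- from that member).  If {2,3} generates, so do {1,2} and {1,3}; every member
-- meets all three pairs, which is exactly membership in AHM₃.  Otherwise every
-- generating pair contains 1, so {1,2} generates, while {1,r+2} does not: a
-- member avoiding 1 misses some element of {2,…,r+2}.  The largest j for which
-- {1,j} generates gives 𝒜 ∈ I_j.  Maximality enters only through the star at 1:
-- if every member contained 1, then 𝒜 would be the whole star and {1} would
-- generate it.

module Submission where

open import Defs
open import Data.Bool using (Bool; true; false; T; _∧_; _∨_)
import Data.Bool.Properties as Bool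
open import Data.Empty using (⊥; ⊥-elim)
open import Data.Fin using (zero; suc; toℕ)
open import Data.Fin.Properties using (toℕ-injective)
open import Data.Fin.Subset using (Subset; ∣_∣; _∩_; _∪_; ∁; Nonempty; _⊆_; _∈_; _∉_)
  renaming (⊥ to ∅)
open import Data.Fin.Subset.Properties
  using ( drop-∷-⊆; s⊆s; out⊆; ⊆-refl; ⊆-trans; ⊥⊆; p⊆q⇒∣p∣≤∣q∣; ∣⊥∣≡0; ∣p∣≤n
        ; x∈p∩q⁻; x∈p∩q⁺; x∈∁p⇒x∉p; x∉p⇒x∈∁p; _⊆?_; anySubset?)
open import Data.List using ([]; _∷_; map; length)
open import Data.List.Properties using (length-map)
open import Data.List.Membership.Propositional using () renaming (_∈_ to _∈ₗ_)
open import Data.List.Membership.Propositional.Properties using (∈-map⁺; ∈-map⁻)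
open import Data.List.Relation.Unary.Any using (here; there)
open import Data.List.Relation.Binary.Pointwise using (Pointwise; []; _∷_; map⁺)
  renaming (map to Pointwise-map)
open import Data.List.Relation.Binary.Pointwise.Properties using (Pointwise-length)
  renaming (refl to Pointwise-refl)
open import Data.Nat
  using (ℕ; zero; suc; _+_; _*_; _∸_; _≤_; _<_; _≤′_; ≤′-refl; ≤′-step; z≤n; s≤s; _≡ᵇ_; _≟_; _≤?_)
open import Data.Nat.Properties
open import Data.Product using (Σ; ∃; ∃₂; _×_; _,_; proj₁; proj₂)
open import Data.Sum using (_⊎_; inj₁; inj₂; [_,_]′)
import Data.Sum as Sum
open import Data.Vec using ([]; _∷_; here; there)
open import Function using (_∘_; id)
open import Function.Bundles using (mk⇔)
open import Relation.Binary.PropositionalEquality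
open import Relation.Nullary using (¬_; Dec; yes; no; contradiction)
open import Relation.Nullary.Decidable using (_×-dec_; ¬?; decidable-stable; T?)
open import Relation.Unary using (Decidable)

private
  variable
    n : ℕ

-- Membership by 0-based index; indices beyond n are absent, so sets such as
-- pair n 1 2 make sense before n is known to be large.
infixl 9 _!_

_!_ : Subset n → ℕ → Bool
[]      ! _     = false
(b ∷ _) ! zero  = b
(_ ∷ A) ! suc k = A ! k

!⇒< : ∀ (A : Subset n) {k} → A ! k ≡ true → k < n
!⇒< (_ ∷ _) {zero}  _   = s≤s z≤n
!⇒< (_ ∷ A) {suc k} k∈A = s≤s (!⇒< A k∈A)

∈⇒! : ∀ {A : Subset n} {x} → x ∈ A → A ! toℕ x ≡ true
∈⇒! here      = refl
∈⇒! (there x∈A) = ∈⇒! x∈A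

!⇒∈ : ∀ (A : Subset n) {k} → A ! k ≡ true → ∃ λ x → toℕ x ≡ k × x ∈ A
!⇒∈ (true ∷ A) {zero}  _   = zero , refl , here
!⇒∈ (_ ∷ A)    {suc k} k∈A with !⇒∈ A k∈A
... | x , refl , x∈A = suc x , refl , there x∈A

⊆⇒! : ∀ {A B : Subset n} {k} → A ⊆ B → A ! k ≡ true → B ! k ≡ true
⊆⇒! {A = A} A⊆B k∈A with !⇒∈ A k∈A
... | _ , refl , x∈A = ∈⇒! (A⊆B x∈A)

!⇒⊆ : ∀ {A B : Subset n} → (∀ k → A ! k ≡ true → B ! k ≡ true) → A ⊆ B
!⇒⊆ {B = B} A⊆B {x} x∈A with !⇒∈ B (A⊆B (toℕ x) (∈⇒! x∈A))
... | y , y≡x , y∈B = subst (_∈ B) (toℕ-injective y≡x) y∈B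

!⇒Nonempty-∩ : ∀ (A B : Subset n) {k} → A ! k ≡ true → B ! k ≡ true → Nonempty (A ∩ B)
!⇒Nonempty-∩ A B k∈A k∈B with !⇒∈ A k∈A | !⇒∈ B k∈B
... | x , x≡k , x∈A | y , y≡k , y∈B =
  x , x∈p∩q⁺ (x∈A , subst (_∈ B) (toℕ-injective (trans y≡k (sym x≡k))) y∈B)

Nonempty-∩⇒! : ∀ {A B : Subset n} → Nonempty (A ∩ B) → ∃ λ k → A ! k ≡ true × B ! k ≡ true
Nonempty-∩⇒! {A = A} {B} (x , x∈A∩B) with x∈p∩q⁻ A B x∈A∩B
... | x∈A , x∈B = toℕ x , ∈⇒! x∈A , ∈⇒! x∈B

!-true-false⇒≢ : ∀ {A : Subset n} {k i} → A ! k ≡ true → A ! i ≡ false → k ≢ i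
!-true-false⇒≢ k∈A i∉A refl = contradiction (trans (sym k∈A) i∉A) λ ()

∈elems⇒! : ∀ (A : Subset n) {k} → k ∈ₗ elems A → A ! k ≡ true
∈elems⇒! (true ∷ A)  {zero}  _ = refl
∈elems⇒! (false ∷ A) {zero}  0∈ with ∈-map⁻ suc 0∈
... | _ , _ , ()
∈elems⇒! (true ∷ A)  {suc k} (there k∈) with ∈-map⁻ suc k∈
... | _ , k∈A , refl = ∈elems⇒! A k∈A
∈elems⇒! (false ∷ A) {suc k} k∈ with ∈-map⁻ suc k∈
... | _ , k∈A , refl = ∈elems⇒! A k∈A

!⇒∈elems : ∀ (A : Subset n) {k} → A ! k ≡ true → k ∈ₗ elems A
!⇒∈elems (true ∷ A)  {zero}  _   = here refl
!⇒∈elems (true ∷ A)  {suc k} k∈A = there (∈-map⁺ suc (!⇒∈elems A k∈A))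
!⇒∈elems (false ∷ A) {suc k} k∈A = ∈-map⁺ suc (!⇒∈elems A k∈A)

∣A∣≡length-elems : ∀ (A : Subset n) → ∣ A ∣ ≡ length (elems A)
∣A∣≡length-elems []          = refl
∣A∣≡length-elems (true ∷ A)  = cong suc (trans (∣A∣≡length-elems A) (sym (length-map suc (elems A))))
∣A∣≡length-elems (false ∷ A) = trans (∣A∣≡length-elems A) (sym (length-map suc (elems A)))

⊆∧≢⇒∣p∣<∣q∣ : ∀ {p q : Subset n} → p ⊆ q → p ≢ q → ∣ p ∣ < ∣ q ∣
⊆∧≢⇒∣p∣<∣q∣ {p = []}      {[]}      _   p≢q = contradiction refl p≢q
⊆∧≢⇒∣p∣<∣q∣ {p = true ∷ p}  {true ∷ q}  p⊆q p≢q = s≤s (⊆∧≢⇒∣p∣<∣q∣ (drop-∷-⊆ p⊆q) (p≢q ∘ cong (true ∷_)))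
⊆∧≢⇒∣p∣<∣q∣ {p = false ∷ p} {false ∷ q} p⊆q p≢q = ⊆∧≢⇒∣p∣<∣q∣ (drop-∷-⊆ p⊆q) (p≢q ∘ cong (false ∷_))
⊆∧≢⇒∣p∣<∣q∣ {p = false ∷ p} {true ∷ q}  p⊆q _   = s≤s (p⊆q⇒∣p∣≤∣q∣ (drop-∷-⊆ p⊆q))
⊆∧≢⇒∣p∣<∣q∣ {p = true ∷ p}  {false ∷ q} p⊆q _   with p⊆q here
... | ()

∣p∪q∣≤∣p∣+∣q∣ : ∀ (p q : Subset n) → ∣ p ∪ q ∣ ≤ ∣ p ∣ + ∣ q ∣
∣p∪q∣≤∣p∣+∣q∣ []          []          = z≤n
∣p∪q∣≤∣p∣+∣q∣ (true ∷ p)  (true ∷ q)  = s≤s (≤-trans (∣p∪q∣≤∣p∣+∣q∣ p q) (+-monoʳ-≤ ∣ p ∣ (n≤1+n ∣ q ∣)))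
∣p∪q∣≤∣p∣+∣q∣ (true ∷ p)  (false ∷ q) = s≤s (∣p∪q∣≤∣p∣+∣q∣ p q)
∣p∪q∣≤∣p∣+∣q∣ (false ∷ p) (true ∷ q)  = ≤-trans (s≤s (∣p∪q∣≤∣p∣+∣q∣ p q)) (≤-reflexive (sym (+-suc ∣ p ∣ ∣ q ∣)))
∣p∪q∣≤∣p∣+∣q∣ (false ∷ p) (false ∷ q) = ∣p∪q∣≤∣p∣+∣q∣ p q

∣A∣≡0⇒A≡∅ : ∀ {A : Subset n} → ∣ A ∣ ≡ 0 → A ≡ ∅
∣A∣≡0⇒A≡∅ {A = []}        _ = refl
∣A∣≡0⇒A≡∅ {A = false ∷ A} e = cong (false ∷_) (∣A∣≡0⇒A≡∅ e)

!⇒0<∣∣ : ∀ (A : Subset n) {k} → A ! k ≡ true → 0 < ∣ A ∣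
!⇒0<∣∣ (true ∷ A)  _           = s≤s z≤n
!⇒0<∣∣ (false ∷ A) {suc k} k∈A = !⇒0<∣∣ A k∈A

!-false⇒∉ : ∀ {A : Subset n} {x} → A ! toℕ x ≡ false → x ∉ A
!-false⇒∉ x∉A x∈A = contradiction (trans (sym (∈⇒! x∈A)) x∉A) λ ()

tabulateℕ : ∀ n → (ℕ → Bool) → Subset n
tabulateℕ zero    f = []
tabulateℕ (suc n) f = f 0 ∷ tabulateℕ n (f ∘ suc)

tabulateℕ-! : ∀ n f {k} → k < n → tabulateℕ n f ! k ≡ f k
tabulateℕ-! (suc n) f {zero}  _       = refl
tabulateℕ-! (suc n) f {suc k} (s≤s k<n) = tabulateℕ-! n (f ∘ suc) k<n

tabulateℕ-false : ∀ n → tabulateℕ n (λ _ → false) ≡ ∅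
tabulateℕ-false zero    = refl
tabulateℕ-false (suc n) = cong (false ∷_) (tabulateℕ-false n)

tabulateℕ-∨ : ∀ n f g → tabulateℕ n (λ k → f k ∨ g k) ≡ tabulateℕ n f ∪ tabulateℕ n g
tabulateℕ-∨ zero    f g = refl
tabulateℕ-∨ (suc n) f g = cong ((f 0 ∨ g 0) ∷_) (tabulateℕ-∨ n (f ∘ suc) (g ∘ suc))

!-false : ∀ {A : Subset n} {k} → ¬ A ! k ≡ true → A ! k ≡ false
!-false {A = A} {k} k∉A with A ! k
... | true  = contradiction refl k∉A
... | false = refl

∨≡true : ∀ {x y} → x ∨ y ≡ true → x ≡ true ⊎ y ≡ true
∨≡true {true}  _ = inj₁ refl
∨≡true {false} e = inj₂ e

≡ᵇ-refl : ∀ a → (a ≡ᵇ a) ≡ true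
≡ᵇ-refl zero    = refl
≡ᵇ-refl (suc a) = ≡ᵇ-refl a

≡ᵇ⇒≡′ : ∀ {a b} → (a ≡ᵇ b) ≡ true → a ≡ b
≡ᵇ⇒≡′ {a} {b} e = ≡ᵇ⇒≡ a b (subst T (sym e) _)

singleton : ∀ n → ℕ → Subset n
singleton n c = tabulateℕ n (_≡ᵇ c)

pair : ∀ n → ℕ → ℕ → Subset n
pair n a b = tabulateℕ n (λ k → (k ≡ᵇ a) ∨ (k ≡ᵇ b))

singleton⁺ : ∀ {c} → c < n → singleton n c ! c ≡ true
singleton⁺ {n} {c} c<n = trans (tabulateℕ-! n (_≡ᵇ c) c<n) (≡ᵇ-refl c)

singleton⁻ : ∀ {c k} → singleton n c ! k ≡ true → k ≡ c
singleton⁻ {n} {c} {k} k∈ = ≡ᵇ⇒≡′ (trans (sym (tabulateℕ-! n (_≡ᵇ c) (!⇒< (singleton n c) k∈))) k∈)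

∣singleton∣≤1 : ∀ n c → ∣ singleton n c ∣ ≤ 1
∣singleton∣≤1 zero    c       = z≤n
∣singleton∣≤1 (suc n) zero    = s≤s (≤-reflexive (trans (cong ∣_∣ (tabulateℕ-false n)) (∣⊥∣≡0 n)))
∣singleton∣≤1 (suc n) (suc c) = ∣singleton∣≤1 n c

∣pair∣≤2 : ∀ n a b → ∣ pair n a b ∣ ≤ 2
∣pair∣≤2 n a b = begin
  ∣ pair n a b ∣                         ≡⟨ cong ∣_∣ (tabulateℕ-∨ n (_≡ᵇ a) (_≡ᵇ b)) ⟩
  ∣ singleton n a ∪ singleton n b ∣       ≤⟨ ∣p∪q∣≤∣p∣+∣q∣ (singleton n a) (singleton n b) ⟩
  ∣ singleton n a ∣ + ∣ singleton n b ∣   ≤⟨ +-mono-≤ (∣singleton∣≤1 n a) (∣singleton∣≤1 n b) ⟩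
  2                                       ∎
  where open ≤-Reasoning

pair⁺ˡ : ∀ {a b} → a < n → pair n a b ! a ≡ true
pair⁺ˡ {n} {a} {b} a<n = begin
  pair n a b ! a          ≡⟨ tabulateℕ-! n (λ k → (k ≡ᵇ a) ∨ (k ≡ᵇ b)) a<n ⟩
  (a ≡ᵇ a) ∨ (a ≡ᵇ b)     ≡⟨ cong (_∨ (a ≡ᵇ b)) (≡ᵇ-refl a) ⟩
  true                    ∎
  where open ≡-Reasoning

pair⁺ʳ : ∀ {a b} → b < n → pair n a b ! b ≡ true
pair⁺ʳ {n} {a} {b} b<n = begin
  pair n a b ! b          ≡⟨ tabulateℕ-! n (λ k → (k ≡ᵇ a) ∨ (k ≡ᵇ b)) b<n ⟩
  (b ≡ᵇ a) ∨ (b ≡ᵇ b)     ≡⟨ cong ((b ≡ᵇ a) ∨_) (≡ᵇ-refl b) ⟩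
  (b ≡ᵇ a) ∨ true         ≡⟨ Bool.∨-zeroʳ (b ≡ᵇ a) ⟩
  true                    ∎
  where open ≡-Reasoning

pair⁻ : ∀ {a b k} → pair n a b ! k ≡ true → k ≡ a ⊎ k ≡ b
pair⁻ {n} {a} {b} {k} k∈ =
  Sum.map ≡ᵇ⇒≡′ ≡ᵇ⇒≡′ (∨≡true (trans (sym (tabulateℕ-! n _ (!⇒< (pair n a b) k∈))) k∈))

pair-⊆ : ∀ {A : Subset n} {a b} → A ! a ≡ true → A ! b ≡ true → pair n a b ⊆ A
pair-⊆ {n} {a = a} {b} a∈A b∈A =
  !⇒⊆ {A = pair n a b} λ k k∈ → [ (λ { refl → a∈A }) , (λ { refl → b∈A }) ]′ (pair⁻ {n} k∈)

pair-⊆-∁ : ∀ {A : Subset n} {a b} → A ! a ≡ false → A ! b ≡ false → pair n a b ⊆ ∁ A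
pair-⊆-∁ {n} a∉A b∉A x∈ab =
  x∉p⇒x∈∁p (!-false⇒∉ ([ (λ { refl → a∉A }) , (λ { refl → b∉A }) ]′ (pair⁻ {n} (∈⇒! x∈ab))))

singleton-meets : ∀ {A : Subset n} {c} → Nonempty (singleton n c ∩ A) → A ! c ≡ true
singleton-meets {n} {A} {c} ne with Nonempty-∩⇒! {A = singleton n c} {A} ne
... | k , k∈c , k∈A = subst (λ k → A ! k ≡ true) (singleton⁻ {n} k∈c) k∈A

pair-∉ : ∀ {a b k} → k ≢ a → k ≢ b → pair n a b ! k ≡ false
pair-∉ {n} {a} {b} k≢a k≢b = !-false {A = pair n a b} ([ k≢a , k≢b ]′ ∘ pair⁻ {n})

elems-∅ : ∀ n → elems (∅ {n}) ≡ []
elems-∅ zero    = refl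
elems-∅ (suc n) = cong (map suc) (elems-∅ n)

elems-singleton : ∀ {c} → c < n → elems (singleton n c) ≡ c ∷ []
elems-singleton {suc n} {zero}  _         =
  cong (λ l → 0 ∷ map suc l) (trans (cong elems (tabulateℕ-false n)) (elems-∅ n))
elems-singleton {suc n} {suc c} (s≤s c<n) = cong (map suc) (elems-singleton c<n)

elems-pair : ∀ {a b} → a < b → b < n → elems (pair n a b) ≡ a ∷ b ∷ []
elems-pair {suc n} {zero}  {suc b} _         (s≤s b<n) = cong (λ l → 0 ∷ map suc l) (elems-singleton b<n)
elems-pair {suc n} {suc a} {suc b} (s≤s a<b) (s≤s b<n) = cong (map suc) (elems-pair a<b b<n)

∣A∣≡1⇒A≡singleton : ∀ {A : Subset n} → ∣ A ∣ ≡ 1 → ∃ λ c → c < n × A ≡ singleton n c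
∣A∣≡1⇒A≡singleton {suc n} {true ∷ A}  e =
  0 , s≤s z≤n , cong (true ∷_) (trans (∣A∣≡0⇒A≡∅ (suc-injective e)) (sym (tabulateℕ-false n)))
∣A∣≡1⇒A≡singleton {suc n} {false ∷ A} e with ∣A∣≡1⇒A≡singleton {A = A} e
... | c , c<n , refl = suc c , s≤s c<n , refl

∣A∣≡2⇒A≡pair : ∀ {A : Subset n} → ∣ A ∣ ≡ 2 → ∃₂ λ a b → a < b × b < n × A ≡ pair n a b
∣A∣≡2⇒A≡pair {suc n} {true ∷ A}  e with ∣A∣≡1⇒A≡singleton {A = A} (suc-injective e)
... | c , c<n , refl = 0 , suc c , s≤s z≤n , s≤s c<n , refl
∣A∣≡2⇒A≡pair {suc n} {false ∷ A} e with ∣A∣≡2⇒A≡pair {A = A} e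
... | a , b , a<b , b<n , refl = suc a , suc b , s≤s a<b , s≤s b<n , refl

≤ₛ⇒∣∣≡ : ∀ {A B : Subset n} → B ≤ₛ A → ∣ B ∣ ≡ ∣ A ∣
≤ₛ⇒∣∣≡ {A = A} {B} B≤A =
  trans (∣A∣≡length-elems B) (trans (Pointwise-length B≤A) (sym (∣A∣≡length-elems A)))

≤ₛ-keeps-0 : ∀ {A B : Subset n} → B ≤ₛ A → A ! 0 ≡ true → B ! 0 ≡ true
≤ₛ-keeps-0 {A = true ∷ A} {B} B≤A _ = ∈elems⇒! B (head≤0 B≤A)
  where
  head≤0 : ∀ {xs ys} → Pointwise _≤_ xs (0 ∷ ys) → 0 ∈ₗ xs
  head≤0 (z≤n ∷ _) = here refl

singleton0-≤ₛ : ∀ {A : Subset n} → 0 < n → ∣ A ∣ ≡ 1 → singleton n 0 ≤ₛ A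
singleton0-≤ₛ {A = A} 0<n ∣A∣≡1 =
  subst (λ xs → Pointwise _≤_ xs (elems A)) (sym (elems-singleton 0<n))
    (0≤single (elems A) (trans (sym (∣A∣≡length-elems A)) ∣A∣≡1))
  where
  0≤single : ∀ xs → length xs ≡ 1 → Pointwise _≤_ (0 ∷ []) xs
  0≤single (_ ∷ []) _ = z≤n ∷ []

∃-shiftUp : ∀ (A : Subset n) i → A ! i ≡ true → A ! suc i ≡ false → suc i < n →
  ∃ λ A′ → A ≤ₛ A′ × ∣ A′ ∣ ≡ ∣ A ∣ × A′ ! suc i ≡ true × (∀ k → k ≢ i → A ! k ≡ true → A′ ! k ≡ true)
∃-shiftUp (true ∷ false ∷ A) zero refl refl _ =
  false ∷ true ∷ A , z≤n ∷ Pointwise-refl ≤-refl , refl , refl , keep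
  where
  keep : ∀ k → k ≢ 0 → (true ∷ false ∷ A) ! k ≡ true → (false ∷ true ∷ A) ! k ≡ true
  keep zero          k≢0 _   = contradiction refl k≢0
  keep (suc (suc k)) _   k∈A = k∈A
∃-shiftUp (b ∷ A) (suc i) i∈A si∉A (s≤s si<n) with ∃-shiftUp A i i∈A si∉A si<n
... | A′ , A≤A′ , ∣A′∣≡∣A∣ , si∈A′ , keep = b ∷ A′ , ≤ₛ-cons b , ∣∣-cons b , si∈A′ , keep′
  where
  ≤ₛ-cons : ∀ b → (b ∷ A) ≤ₛ (b ∷ A′)
  ≤ₛ-cons true  = z≤n ∷ map⁺ suc suc (Pointwise-map s≤s A≤A′)
  ≤ₛ-cons false = map⁺ suc suc (Pointwise-map s≤s A≤A′)
  ∣∣-cons : ∀ b → ∣ b ∷ A′ ∣ ≡ ∣ b ∷ A ∣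
  ∣∣-cons true  = cong suc ∣A′∣≡∣A∣
  ∣∣-cons false = ∣A′∣≡∣A∣
  keep′ : ∀ k → k ≢ suc i → (b ∷ A) ! k ≡ true → (b ∷ A′) ! k ≡ true
  keep′ zero    _    0∈A = 0∈A
  keep′ (suc k) k≢si k∈A = keep k (k≢si ∘ cong suc) k∈A

∃-missing-≤∣∣ : ∀ (A : Subset n) → ∃ λ k → k ≤ ∣ A ∣ × A ! k ≡ false
∃-missing-≤∣∣ []          = 0 , z≤n , refl
∃-missing-≤∣∣ (false ∷ A) = 0 , z≤n , refl
∃-missing-≤∣∣ (true ∷ A) with ∃-missing-≤∣∣ A
... | k , k≤∣A∣ , k∉A = suc k , s≤s k≤∣A∣ , k∉A

∃-missing-after-0 : ∀ (A : Subset n) → A ! 0 ≡ false → ∃ λ k → k ≤ ∣ A ∣ × A ! suc k ≡ false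
∃-missing-after-0 []          _ = 0 , z≤n , refl
∃-missing-after-0 (false ∷ A) _ = ∃-missing-≤∣∣ A

extend-disjoint : ∀ (T A : Subset n) m → T ⊆ ∁ A → m + ∣ T ∣ + ∣ A ∣ ≤ n →
  ∃ λ B → T ⊆ B × ∣ B ∣ ≡ m + ∣ T ∣ × B ⊆ ∁ A
extend-disjoint T A zero T⊆∁A _ = T , ⊆-refl , refl , T⊆∁A
extend-disjoint [] [] (suc m) _ ()
extend-disjoint (true ∷ T) (true ∷ A) m T⊆∁A _ with T⊆∁A here
... | ()
extend-disjoint {suc n} (true ∷ T) (false ∷ A) m T⊆∁A bound
  with extend-disjoint T A m (drop-∷-⊆ T⊆∁A)
         (≤-pred (subst (λ t → t + ∣ A ∣ ≤ suc n) (+-suc m ∣ T ∣) bound))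
... | B , T⊆B , ∣B∣ , B⊆∁A =
  true ∷ B , s⊆s T⊆B , trans (cong suc ∣B∣) (sym (+-suc m ∣ T ∣)) , s⊆s B⊆∁A
extend-disjoint {suc n} (false ∷ T) (true ∷ A) m T⊆∁A bound
  with extend-disjoint T A m (drop-∷-⊆ T⊆∁A)
         (≤-pred (subst (_≤ suc n) (+-suc (m + ∣ T ∣) ∣ A ∣) bound))
... | B , T⊆B , ∣B∣ , B⊆∁A = false ∷ B , s⊆s T⊆B , ∣B∣ , s⊆s B⊆∁A
extend-disjoint (false ∷ T) (false ∷ A) (suc m) T⊆∁A (s≤s bound)
  with extend-disjoint T A m (drop-∷-⊆ T⊆∁A) bound
... | B , T⊆B , ∣B∣ , B⊆∁A = true ∷ B , out⊆ T⊆B , cong suc ∣B∣ , s⊆s B⊆∁A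

crossing : ∀ {ℓ} (P : ℕ → Set ℓ) → Decidable P → ∀ a d → P a → ¬ P (d + a) →
  ∃ λ j → a ≤ j × suc j ≤ d + a × P j × ¬ P (suc j)
crossing P P? a zero    Pa ¬Pa = contradiction Pa ¬Pa
crossing P P? a (suc d) Pa ¬Pd+a with P? (suc a)
... | no ¬Pa+1 = a , ≤-refl , s≤s (m≤n+m a d) , Pa , ¬Pa+1
... | yes Pa+1 with crossing P P? (suc a) d Pa+1 (subst (¬_ ∘ P) (sym (+-suc d a)) ¬Pd+a)
... | j , a<j , j<d+a , Pj , ¬Pj+1 = j , <⇒≤ a<j , subst (suc j ≤_) (+-suc d a) j<d+a , Pj , ¬Pj+1

module PotentialGenerators {n} (r : ℕ) (𝒜 : Family n) where

  PG : Subset n → Set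
  PG = IsPotentialGenerator r 𝒜

  PG? : ∀ G → Dec (PG G)
  PG? G with anySubset? (λ A → (∣ A ∣ ≟ r) ×-dec (G ⊆? A) ×-dec ¬? (T? (𝒜 A)))
  ... | yes (A , ∣A∣≡r , G⊆A , A∉𝒜) = no λ PG-G → A∉𝒜 (PG-G A ∣A∣≡r G⊆A)
  ... | no ∄ = yes λ A ∣A∣≡r G⊆A → decidable-stable (T? (𝒜 A)) λ A∉𝒜 → ∄ (A , ∣A∣≡r , G⊆A , A∉𝒜)

  PG-mono : ∀ {G H} → PG G → G ⊆ H → PG H
  PG-mono PG-G G⊆H A ∣A∣≡r H⊆A = PG-G A ∣A∣≡r (⊆-trans G⊆H H⊆A)

  PG-pair⇒∈ : ∀ {A a b} → PG (pair n a b) → ∣ A ∣ ≡ r → A ! a ≡ true → A ! b ≡ true → A ∈F 𝒜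
  PG-pair⇒∈ {A} PG-ab ∣A∣≡r a∈A b∈A = PG-ab A ∣A∣≡r (pair-⊆ a∈A b∈A)

  ¬PG-∅ : ∀ {k} → HasRank r 𝒜 (suc k) → ¬ PG ∅
  ¬PG-∅ ((G₀ , (_ , minimal) , ∣G₀∣≡1+k) , _) =
    minimal ∅ ⊥⊆ λ ∅≡G₀ → 0≢1+n (trans (sym (∣⊥∣≡0 n)) (trans (cong ∣_∣ ∅≡G₀) ∣G₀∣≡1+k))

  ¬PG-∣∣≤1 : ∀ {G} → HasRank r 𝒜 2 → ∣ G ∣ ≤ 1 → ¬ PG G
  ¬PG-∣∣≤1 {G} rank2 ∣G∣≤1 PG-G =
    contradiction (≤-trans (proj₂ rank2 G (PG-G , proper)) ∣G∣≤1) λ { (s≤s ()) }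
    where
    proper : ∀ H → H ⊆ G → H ≢ G → ¬ PG H
    proper H H⊆G H≢G =
      ¬PG-∅ rank2 ∘ subst PG (∣A∣≡0⇒A≡∅ (n<1⇒n≡0 (<-≤-trans (⊆∧≢⇒∣p∣<∣q∣ H⊆G H≢G) ∣G∣≤1)))

  PG-∣∣≡2⇒generator : ∀ {G} → HasRank r 𝒜 2 → PG G → ∣ G ∣ ≡ 2 → IsGenerator r 𝒜 G
  PG-∣∣≡2⇒generator rank2 PG-G ∣G∣≡2 = PG-G , λ H H⊆G H≢G →
    ¬PG-∣∣≤1 rank2 (≤-pred (subst (∣ H ∣ <_) ∣G∣≡2 (⊆∧≢⇒∣p∣<∣q∣ H⊆G H≢G)))

  module LeftCompressed (LC : IsLeftCompressed 𝒜) where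

    -- If A ⊇ G′ lacks i+1, moving i to i+1 in A gives A′ ⊇ G with A ≤ₛ A′, and
    -- left compression carries A′ ∈ 𝒜 back to A.
    PG-shiftDown : ∀ {G G′ i} → PG G → G ! i ≡ false → (G ! suc i ≡ true → G′ ! i ≡ true) →
      (∀ k → G ! k ≡ true → k ≡ suc i ⊎ G′ ! k ≡ true) → PG G′
    PG-shiftDown {G} {G′} {i} PG-G i∉G si∈G⇒i∈G′ G⊆G′+si with G ! suc i Bool.≟ true
    ... | no si∉G =
      PG-mono PG-G (!⇒⊆ λ k k∈G → [ (λ { refl → contradiction k∈G si∉G }) , id ]′ (G⊆G′+si k k∈G))
    ... | yes si∈G = PG-G′
      where
      G⊆ : ∀ {A X} → G′ ⊆ A → X ! suc i ≡ true → (∀ k → k ≢ i → A ! k ≡ true → X ! k ≡ true) → G ⊆ X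
      G⊆ {A} {X} G′⊆A si∈X A⊆X = !⇒⊆ cover
        where
        cover : ∀ k → G ! k ≡ true → X ! k ≡ true
        cover k k∈G with G⊆G′+si k k∈G
        ... | inj₁ refl = si∈X
        ... | inj₂ k∈G′ = A⊆X k (!-true-false⇒≢ {A = G} k∈G i∉G) (⊆⇒! G′⊆A k∈G′)
      PG-G′ : PG G′
      PG-G′ A ∣A∣≡r G′⊆A with A ! suc i in si∈A
      ... | true  = PG-G A ∣A∣≡r (G⊆ G′⊆A si∈A λ _ _ → id)
      ... | false with ∃-shiftUp A i (⊆⇒! G′⊆A (si∈G⇒i∈G′ si∈G)) si∈A (!⇒< G si∈G)
      ...   | A′ , A≤A′ , ∣A′∣≡∣A∣ , si∈A′ , keep =
        LC A′ A (PG-G A′ (trans ∣A′∣≡∣A∣ ∣A∣≡r) (G⊆ G′⊆A si∈A′ keep)) A≤A′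

    PG-pair-lowerFst : ∀ {a′ a b} → a′ ≤′ a → a < b → PG (pair n a b) → PG (pair n a′ b)
    PG-pair-lowerFst ≤′-refl _ PG-ab = PG-ab
    PG-pair-lowerFst {a = suc a} {b} (≤′-step a′≤a) 1+a<b PG-ab =
      PG-pair-lowerFst a′≤a a<b (PG-shiftDown PG-ab
        (pair-∉ {n} (<⇒≢ (n<1+n a)) (<⇒≢ a<b))
        (λ 1+a∈ → pair⁺ˡ (<-trans (n<1+n a) (!⇒< (pair n (suc a) b) 1+a∈)))
        (λ k k∈ → Sum.map id (λ { refl → pair⁺ʳ (!⇒< (pair n (suc a) b) k∈) }) (pair⁻ {n} k∈)))
      where
      a<b = <-trans (n<1+n a) 1+a<b

    PG-pair-lowerSnd : ∀ {a b′ b} → b′ ≤′ b → a < b′ → PG (pair n a b) → PG (pair n a b′)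
    PG-pair-lowerSnd ≤′-refl _ PG-ab = PG-ab
    PG-pair-lowerSnd {a} {b = suc b} (≤′-step b′≤b) a<b′ PG-ab =
      PG-pair-lowerSnd b′≤b a<b′ (PG-shiftDown PG-ab
        (pair-∉ {n} (>⇒≢ a<b) (<⇒≢ (n<1+n b)))
        (λ 1+b∈ → pair⁺ʳ (<-trans (n<1+n b) (!⇒< (pair n a (suc b)) 1+b∈)))
        (λ k k∈ → [ (λ { refl → inj₂ (pair⁺ˡ (!⇒< (pair n a (suc b)) k∈)) }) , inj₁ ]′ (pair⁻ {n} k∈)))
      where
      a<b = <-≤-trans a<b′ (≤′⇒≤ b′≤b)

    PG-pair-≤ : ∀ {a′ b′ a b} → a′ ≤ a → b′ ≤ b → a′ < b′ → a < b → PG (pair n a b) → PG (pair n a′ b′)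
    PG-pair-≤ a′≤a b′≤b a′<b′ a<b =
      PG-pair-lowerSnd (≤⇒≤′ b′≤b) a′<b′ ∘ PG-pair-lowerFst (≤⇒≤′ a′≤a) a<b

  module Intersecting (2r≤n : 2 * r ≤ n) (uniform : IsUniform r 𝒜)
                      (intersecting : IsIntersecting 𝒜) where

    PG-meets : ∀ {T A} → PG T → ∣ T ∣ ≤ r → A ∈F 𝒜 → ¬ T ⊆ ∁ A
    PG-meets {T} {A} PG-T ∣T∣≤r A∈𝒜 T⊆∁A =
      let B , T⊆B , ∣B∣≡ , B⊆∁A = extend-disjoint T A (r ∸ ∣ T ∣) T⊆∁A bound
          x , x∈B∩A = intersecting B A (PG-T B (trans ∣B∣≡ (m∸n+n≡m ∣T∣≤r)) T⊆B) A∈𝒜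
          x∈B , x∈A = x∈p∩q⁻ B A x∈B∩A
      in x∈∁p⇒x∉p (B⊆∁A x∈B) x∈A
      where
      bound : r ∸ ∣ T ∣ + ∣ T ∣ + ∣ A ∣ ≤ n
      bound = begin
        r ∸ ∣ T ∣ + ∣ T ∣ + ∣ A ∣ ≡⟨ cong₂ _+_ (m∸n+n≡m ∣T∣≤r) (uniform A A∈𝒜) ⟩
        r + r                     ≡⟨ cong (r +_) (sym (+-identityʳ r)) ⟩
        2 * r                     ≤⟨ 2r≤n ⟩
        n                         ∎
        where open ≤-Reasoning

    PG-pair-meets : ∀ {A a b} → 2 ≤ r → PG (pair n a b) → A ∈F 𝒜 → A ! a ≡ false → A ! b ≡ false → ⊥
    PG-pair-meets {a = a} {b} 2≤r PG-ab A∈𝒜 a∉A b∉A =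
      PG-meets PG-ab (≤-trans (∣pair∣≤2 n a b) 2≤r) A∈𝒜 (pair-⊆-∁ a∉A b∉A)

star : ∀ n → ℕ → Family n
star n r A = A ! 0 ∧ (∣ A ∣ ≡ᵇ r)

star⁺ : ∀ {r} (A : Subset n) → A ! 0 ≡ true → ∣ A ∣ ≡ r → A ∈F star n r
star⁺ {r = r} A 0∈A ∣A∣≡r rewrite 0∈A = ≡⇒≡ᵇ ∣ A ∣ r ∣A∣≡r

star⁻ : ∀ {r} (A : Subset n) → A ∈F star n r → A ! 0 ≡ true × ∣ A ∣ ≡ r
star⁻ {r = r} A A∈ with A ! 0
... | true = refl , ≡ᵇ⇒≡ ∣ A ∣ r A∈

star-LCIF : ∀ n r → IsLCIF n r (star n r)
star-LCIF n r = uniform , leftCompressed , intersecting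
  where
  uniform : IsUniform r (star n r)
  uniform A = proj₂ ∘ star⁻ A
  leftCompressed : IsLeftCompressed (star n r)
  leftCompressed A B A∈ B≤A with star⁻ A A∈
  ... | 0∈A , ∣A∣≡r = star⁺ B (≤ₛ-keeps-0 {A = A} {B} B≤A 0∈A) (trans (≤ₛ⇒∣∣≡ {A = A} {B} B≤A) ∣A∣≡r)
  intersecting : IsIntersecting (star n r)
  intersecting A B A∈ B∈ = !⇒Nonempty-∩ A B (proj₁ (star⁻ A A∈)) (proj₁ (star⁻ B B∈))

⊆star⇒PG-singleton0 : ∀ {r} {𝒜 : Family n} → IsMLCIF n r 𝒜 → 0 < n →
  (∀ A → A ∈F 𝒜 → A ! 0 ≡ true) → IsPotentialGenerator r 𝒜 (singleton n 0)
⊆star⇒PG-singleton0 {n} {r} ((uniform , _) , maximal) 0<n members-∋0 A ∣A∣≡r 0⊆A =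
  maximal (star n r) (star-LCIF n r) (λ B B∈𝒜 → star⁺ B (members-∋0 B B∈𝒜) (uniform B B∈𝒜)) A
    (star⁺ A (⊆⇒! 0⊆A (singleton⁺ 0<n)) ∣A∣≡r)

module MaximalRank2 {n r} (2r≤n : 2 * r ≤ n) {𝒜 : Family n}
                    (M : IsMLCIF n r 𝒜) (rank2 : HasRank r 𝒜 2) where

  open PotentialGenerators r 𝒜

  uniform : IsUniform r 𝒜
  uniform = proj₁ (proj₁ M)

  leftCompressed : IsLeftCompressed 𝒜
  leftCompressed = proj₁ (proj₂ (proj₁ M))

  intersecting : IsIntersecting 𝒜
  intersecting = proj₂ (proj₂ (proj₁ M))

  open LeftCompressed leftCompressed
  open Intersecting 2r≤n uniform intersecting

  0<n : 0 < n
  0<n with proj₁ rank2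
  ... | G₀ , _ , ∣G₀∣≡2 = <-≤-trans (s≤s z≤n) (subst (_≤ n) ∣G₀∣≡2 (∣p∣≤n G₀))

  ¬members-∋0 : ¬ (∀ A → A ∈F 𝒜 → A ! 0 ≡ true)
  ¬members-∋0 = ¬PG-∣∣≤1 rank2 (∣singleton∣≤1 n 0) ∘ ⊆star⇒PG-singleton0 M 0<n

  r≤1⇒members-∋0 : r ≤ 1 → ∀ A → A ∈F 𝒜 → A ! 0 ≡ true
  r≤1⇒members-∋0 r≤1 A A∈𝒜 = singleton-meets {A = A} (intersecting (singleton n 0) A 0∈𝒜 A∈𝒜)
    where
    ∣A∣≡1 : ∣ A ∣ ≡ 1
    ∣A∣≡1 with Nonempty-∩⇒! {A = A} {A} (intersecting A A A∈𝒜 A∈𝒜)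
    ... | _ , k∈A , _ = ≤-antisym (subst (_≤ 1) (sym (uniform A A∈𝒜)) r≤1) (!⇒0<∣∣ A k∈A)
    0∈𝒜 : singleton n 0 ∈F 𝒜
    0∈𝒜 = leftCompressed A (singleton n 0) A∈𝒜 (singleton0-≤ₛ {A = A} 0<n ∣A∣≡1)

  2≤r : 2 ≤ r
  2≤r = ≰⇒> (¬members-∋0 ∘ r≤1⇒members-∋0)

  ahm3 : PG (pair n 1 2) → IsAHM3 r 𝒜
  ahm3 PG12 A = mk⇔ to from
    where
    PG01 : PG (pair n 0 1)
    PG01 = PG-pair-≤ z≤n (s≤s z≤n) (s≤s z≤n) (s≤s (s≤s z≤n)) PG12
    PG02 : PG (pair n 0 2)
    PG02 = PG-pair-≤ z≤n ≤-refl (s≤s z≤n) (s≤s (s≤s z≤n)) PG12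
    to : A ∈F 𝒜 → InAHM3 r A
    to A∈𝒜 with A ! 0 in e0 | A ! 1 in e1 | A ! 2 in e2
    ... | true  | true  | _     = uniform A A∈𝒜 , inj₁ (!⇒∈elems A e0 , inj₁ (!⇒∈elems A e1))
    ... | true  | false | true  = uniform A A∈𝒜 , inj₁ (!⇒∈elems A e0 , inj₂ (!⇒∈elems A e2))
    ... | false | true  | true  = uniform A A∈𝒜 , inj₂ (!⇒∈elems A e1 , !⇒∈elems A e2)
    ... | true  | false | false = ⊥-elim (PG-pair-meets 2≤r PG12 A∈𝒜 e1 e2)
    ... | false | true  | false = ⊥-elim (PG-pair-meets 2≤r PG02 A∈𝒜 e0 e2)
    ... | false | false | _     = ⊥-elim (PG-pair-meets 2≤r PG01 A∈𝒜 e0 e1)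
    from : InAHM3 r A → A ∈F 𝒜
    from (∣A∣≡r , inj₁ (1∈A , inj₁ 2∈A)) = PG-pair⇒∈ PG01 ∣A∣≡r (∈elems⇒! A 1∈A) (∈elems⇒! A 2∈A)
    from (∣A∣≡r , inj₁ (1∈A , inj₂ 3∈A)) = PG-pair⇒∈ PG02 ∣A∣≡r (∈elems⇒! A 1∈A) (∈elems⇒! A 3∈A)
    from (∣A∣≡r , inj₂ (2∈A , 3∈A))      = PG-pair⇒∈ PG12 ∣A∣≡r (∈elems⇒! A 2∈A) (∈elems⇒! A 3∈A)

  module _ (¬PG12 : ¬ PG (pair n 1 2)) where

    PG-pair⇒fst≡0 : ∀ {a b} → a < b → PG (pair n a b) → a ≡ 0
    PG-pair⇒fst≡0 {zero}  _   _     = refl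
    PG-pair⇒fst≡0 {suc a} a<b PG-ab =
      contradiction (PG-pair-≤ (s≤s z≤n) (≤-trans (s≤s (s≤s z≤n)) a<b) (s≤s (s≤s z≤n)) a<b PG-ab) ¬PG12

    PG01 : PG (pair n 0 1)
    PG01 with proj₁ rank2
    ... | G₀ , (PG-G₀ , _) , ∣G₀∣≡2 with ∣A∣≡2⇒A≡pair {A = G₀} ∣G₀∣≡2
    ... | a , b , a<b , _ , refl with PG-pair⇒fst≡0 a<b PG-G₀
    ... | refl = PG-pair-≤ z≤n a<b (s≤s z≤n) a<b PG-G₀

    ¬PG-0,r+1 : ¬ PG (pair n 0 (r + 1))
    ¬PG-0,r+1 PG-0,r+1 = ¬members-∋0 members-∋0
      where
      members-∋0 : ∀ A → A ∈F 𝒜 → A ! 0 ≡ true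
      members-∋0 A A∈𝒜 with A ! 0 in 0∉A
      ... | true  = refl
      ... | false with ∃-missing-after-0 A 0∉A
      ...   | k , k≤∣A∣ , 1+k∉A = ⊥-elim (PG-pair-meets 2≤r PG-0,1+k A∈𝒜 0∉A 1+k∉A)
        where
        1+k≤r+1 : suc k ≤ r + 1
        1+k≤r+1 = ≤-trans (s≤s (subst (k ≤_) (uniform A A∈𝒜) k≤∣A∣)) (≤-reflexive (+-comm 1 r))
        PG-0,1+k : PG (pair n 0 (suc k))
        PG-0,1+k = PG-pair-≤ z≤n 1+k≤r+1 (s≤s z≤n) (m≤n+m 1 r) PG-0,r+1

    module _ {j} (1≤j : 1 ≤ j) (PGj : PG (pair n 0 j)) (¬PGj+1 : ¬ PG (pair n 0 (suc j))) where

      generator⇒ : ∀ G → IsGenerator r 𝒜 G × ∣ G ∣ ≡ 2 →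
        Σ ℕ λ k → 2 ≤ k × k ≤ suc j × elems G ≡ 0 ∷ k ∸ 1 ∷ []
      generator⇒ G ((PG-G , _) , ∣G∣≡2) with ∣A∣≡2⇒A≡pair {A = G} ∣G∣≡2
      ... | a , b , a<b , b<n , refl with PG-pair⇒fst≡0 a<b PG-G | b ≤? j
      ... | refl | yes b≤j = suc b , s≤s a<b , s≤s b≤j , elems-pair a<b b<n
      ... | refl | no  b≰j = contradiction (PG-pair-≤ z≤n (≰⇒> b≰j) (s≤s z≤n) a<b PG-G) ¬PGj+1

      ⇒generator : ∀ G → (Σ ℕ λ k → 2 ≤ k × k ≤ suc j × elems G ≡ 0 ∷ k ∸ 1 ∷ []) →
        IsGenerator r 𝒜 G × ∣ G ∣ ≡ 2
      ⇒generator G (suc b , s≤s 1≤b , s≤s b≤j , elems-G) = PG-∣∣≡2⇒generator rank2 PG-G ∣G∣≡2 , ∣G∣≡2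
        where
        ∣G∣≡2 : ∣ G ∣ ≡ 2
        ∣G∣≡2 = trans (∣A∣≡length-elems G) (cong length elems-G)
        PG-G : PG G
        PG-G = PG-mono (PG-pair-≤ z≤n b≤j 1≤b 1≤j PGj)
          (pair-⊆ (∈elems⇒! G (subst (0 ∈ₗ_) (sym elems-G) (here refl)))
                  (∈elems⇒! G (subst (b ∈ₗ_) (sym elems-G) (there (here refl)))))

    -- Index j is the paper's element j+1, hence the witness suc j.
    inI : Σ ℕ λ j → 2 ≤ j × j ≤ r + 1 × InI n r j 𝒜
    inI with crossing (PG ∘ pair n 0) (PG? ∘ pair n 0) 1 r PG01 ¬PG-0,r+1
    ... | j , 1≤j , j<r+1 , PGj , ¬PGj+1 =
      suc j , s≤s 1≤j , j<r+1 , M , rank2 ,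
      λ G → mk⇔ (generator⇒ 1≤j PGj ¬PGj+1 G) (⇒generator 1≤j PGj ¬PGj+1 G)

proposition2p7 : (n r : ℕ) → 2 * r ≤ n → (𝒜 : Family n) →
    IsMLCIF n r 𝒜 → HasRank r 𝒜 2 →
    IsAHM3 r 𝒜 ⊎ (Σ ℕ λ j → 2 ≤ j × j ≤ r + 1 × InI n r j 𝒜)
proposition2p7 n r 2r≤n 𝒜 M rank2 with PotentialGenerators.PG? r 𝒜 (pair n 1 2)
... | yes PG12  = inj₁ (MaximalRank2.ahm3 2r≤n M rank2 PG12)
... | no  ¬PG12 = inj₂ (MaximalRank2.inI 2r≤n M rank2 ¬PG12)
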